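{- For every optiongraph $\mathsf{D}$, the set $\mathrm{Con}(\mathsf{D})$ of congruence relations on $\mathsf{D}$ forms a complete lattice under inclusion.
   Context: An optiongraph is a nonempty set $\mathsf{D}$ (of positions, possibly infinite) together with an option function $\mathrm{Opt}:\mathsf{D}\to 2^{\mathsf{D}}$. For an equivalence relation $\theta$ on $\mathsf{D}$, write $[p]_\theta$ for the class of $p$ and $[S]_\theta:=\{[s]_\theta\mid s\in S\}$. An equivalence relation $\theta$ on $\mathsf{D}$ is a congruence relation if $p\mathrel{\theta}q$ implies $[\mathrm{Opt}(p)]_\theta=[\mathrm{Opt}(q)]_\theta$. -}

module Defs where

open import Level using (Level; suc)
open import Data.Product using (Σ; ∃; _×_)
open import Relation.Unary using (Pred; _∈_)
open import Relation.Binary.Core using (Rel; _⇒_)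
open import Relation.Binary.Structures using (IsEquivalence)

record Optiongraph (ℓ : Level) : Set (suc ℓ) where
  field
    Pos      : Set ℓ
    inhabited : Pos
    Opt      : Pos → Pred Pos ℓ

module _ {ℓ : Level} (G : Optiongraph ℓ) where
  open Optiongraph G

  -- [Opt p]_θ = [Opt q]_θ, unfolded: every class of an option of p is the
  -- class of an option of q and vice versa ([s]_θ = [t]_θ iff s θ t).
  SameClasses : Rel Pos ℓ → Pos → Pos → Set ℓ
  SameClasses θ p q =
    (∀ {s} → s ∈ Opt p → ∃ λ t → t ∈ Opt q × θ s t) ×
    (∀ {t} → t ∈ Opt q → ∃ λ s → s ∈ Opt p × θ s t)

  record IsCongruence (θ : Rel Pos ℓ) : Set ℓ where
    field
      isEquivalence : IsEquivalence θ
      compatible    : ∀ {p q} → θ p q → SameClasses θ p q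

  record Congruence : Set (suc ℓ) where
    field
      rel          : Rel Pos ℓ
      isCongruence : IsCongruence rel
  open Congruence public

  _⊑_ : Congruence → Congruence → Set ℓ
  θ ⊑ σ = rel θ ⇒ rel σ

  IsSupremum : {I : Set ℓ} → (I → Congruence) → Congruence → Set (suc ℓ)
  IsSupremum θs σ = (∀ i → θs i ⊑ σ) × (∀ τ → (∀ i → θs i ⊑ τ) → σ ⊑ τ)

  IsInfimum : {I : Set ℓ} → (I → Congruence) → Congruence → Set (suc ℓ)
  IsInfimum θs σ = (∀ i → σ ⊑ θs i) × (∀ τ → (∀ i → τ ⊑ θs i) → τ ⊑ σ)

  ConIsCompleteLattice : Set (suc ℓ)
  ConIsCompleteLattice =
    (I : Set ℓ) (θs : I → Congruence) →
    (∃ λ σ → IsSupremum θs σ) × (∃ λ σ → IsInfimum θs σ)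

-- Joins in Con(D) are the equivalence closure of the union. Meets are not
-- intersections: the meet of a family is the largest relation inside the
-- intersection that is compatible with Opt, a greatest fixed point.
-- Predicatively it is built as an ω-limit: an element is a sequence of
-- depth-n witness trees (a depth-(n+1) tree answers every option on either
-- side by an option on the other, with depth-n subtrees), each extending the
-- previous one. Coherence of the witnesses, not merely their existence at
-- every depth, is what makes the limit compatible; the intersection of the
-- depth-n relations fails for infinitely branching Opt.
module Submission where

open import Defs
open import Level using (Level)
open import Data.Nat using (ℕ; zero; suc)
open import Data.Unit.Polymorphic using (⊤; tt)
open import Data.Product using (Σ; ∃; _×_; _,_; proj₁; proj₂; map₂)
open import Function using (flip; _∘_)
open import Relation.Binary.PropositionalEquality using (_≡_; refl; trans; subst₂)
open import Relation.Unary using (_∈_)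
open import Relation.Binary.Core using (Rel; _⇒_)
open import Relation.Binary.Definitions using (Reflexive; Transitive)
open import Relation.Binary.Structures using (IsEquivalence)
open import Relation.Binary.Construct.Composition using (_;_)
open import Relation.Binary.Construct.Closure.ReflexiveTransitive
  using (Star; ε; _◅◅_; fold; reverse; return)

module _ {ℓ : Level} (G : Optiongraph ℓ) where
  open Optiongraph G

  module Con (τ : Congruence G) where
    open IsCongruence (isCongruence τ) public
    open IsEquivalence isEquivalence public

  SameClasses-map : ∀ {θ σ : Rel Pos ℓ} → θ ⇒ σ → SameClasses G θ ⇒ SameClasses G σ
  SameClasses-map θ⇒σ (forth , back) =
    (map₂ (map₂ θ⇒σ) ∘ forth) , (map₂ (map₂ θ⇒σ) ∘ back)

  SameClasses-refl : ∀ {θ : Rel Pos ℓ} → Reflexive θ → Reflexive (SameClasses G θ)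
  SameClasses-refl θ-refl = (λ {s} s∈ → s , s∈ , θ-refl) , (λ {t} t∈ → t , t∈ , θ-refl)

  SameClasses-flip : ∀ {θ : Rel Pos ℓ} {p q} →
                     SameClasses G θ p q → SameClasses G (flip θ) q p
  SameClasses-flip (forth , back) = back , forth

  SameClasses-compose : ∀ {θ σ : Rel Pos ℓ} {p q r} →
                        SameClasses G θ p q → SameClasses G σ q r →
                        SameClasses G (θ ; σ) p r
  SameClasses-compose (forth₁ , back₁) (forth₂ , back₂) =
    (λ s∈ → let (t , t∈ , st) = forth₁ s∈ ; (u , u∈ , tu) = forth₂ t∈
            in u , u∈ , (t , st , tu)) ,
    (λ u∈ → let (t , t∈ , tu) = back₂ u∈ ; (s , s∈ , st) = back₁ t∈
            in s , s∈ , (t , st , tu))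

  SameClasses-trans : ∀ {θ : Rel Pos ℓ} → Transitive θ → Transitive (SameClasses G θ)
  SameClasses-trans θ-trans c d =
    SameClasses-map (λ (_ , x , y) → θ-trans x y) (SameClasses-compose c d)

  Star-compatible : ∀ {θ : Rel Pos ℓ} →
                    θ ⇒ SameClasses G (Star θ) → Star θ ⇒ SameClasses G (Star θ)
  Star-compatible θ-compatible =
    fold (SameClasses G (Star _)) (SameClasses-trans _◅◅_ ∘ θ-compatible)
         (SameClasses-refl ε)

  module GreatestCompatible (E : Rel Pos ℓ) where

    Approx : ℕ → Rel Pos ℓ
    Approx zero    _ _ = ⊤
    Approx (suc n) p q = E p q × SameClasses G (Approx n) p q

    -- Truncating x to depth n gives y; the endpoints of the two trees agree
    -- only up to the given equalities, since subtrees are reached through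
    -- replies chosen separately at each depth.
    Extends : ∀ n {p q p′ q′} → p ≡ p′ → q ≡ q′ →
              Approx (suc n) p q → Approx n p′ q′ → Set ℓ
    Extends zero    _    _    _               _                 = ⊤
    Extends (suc n) {p} {q} refl refl (_ , forth , back) (_ , forth′ , back′) =
      (∀ {s} (s∈ : s ∈ Opt p) →
         let (t , _ , x) = forth s∈ ; (t′ , _ , y) = forth′ s∈
         in Σ (t ≡ t′) λ e → Extends n refl e x y) ×
      (∀ {t} (t∈ : t ∈ Opt q) →
         let (s , _ , x) = back t∈ ; (s′ , _ , y) = back′ t∈
         in Σ (s ≡ s′) λ e → Extends n e refl x y)

    Extends-rebase : ∀ n {p q p′ q′ r s} {ep : p ≡ p′} {eq : q ≡ q′}
                     {x : Approx (suc n) p q} {y : Approx n p′ q′}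
                     (a : p ≡ r) (b : q ≡ s) (a′ : p′ ≡ r) (b′ : q′ ≡ s) →
                     Extends n ep eq x y →
                     Extends n refl refl (subst₂ (Approx (suc n)) a b x)
                                         (subst₂ (Approx n) a′ b′ y)
    Extends-rebase n {ep = refl} {refl} refl refl refl refl ext = ext

    ν : Rel Pos ℓ
    ν p q = Σ (∀ n → Approx n p q) λ a → ∀ n → Extends n refl refl (a (suc n)) (a n)

    ν⇒E : ν ⇒ E
    ν⇒E (a , _) = proj₁ (a 1)

    ν-fromChain : (ps qs : ℕ → Pos)
                  (ep : ∀ n → ps (suc n) ≡ ps n) (eq : ∀ n → qs (suc n) ≡ qs n)
                  (a : ∀ n → Approx n (ps n) (qs n)) →
                  (∀ n → Extends n (ep n) (eq n) (a (suc n)) (a n)) →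
                  ν (ps 0) (qs 0)
    ν-fromChain ps qs ep eq a coherent =
      (λ n → subst₂ (Approx n) (toStart ep n) (toStart eq n) (a n)) ,
      (λ n → Extends-rebase n (toStart ep (suc n)) (toStart eq (suc n))
                              (toStart ep n) (toStart eq n) (coherent n))
      where
      toStart : {xs : ℕ → Pos} → (∀ n → xs (suc n) ≡ xs n) → ∀ n → xs n ≡ xs 0
      toStart e zero    = refl
      toStart e (suc n) = trans (e n) (toStart e n)

    ν-compatible : ν ⇒ SameClasses G ν
    ν-compatible {p} {q} (a , coherent) = forth , back
      where
      forth : ∀ {s} → s ∈ Opt p → ∃ λ t → t ∈ Opt q × ν s t
      forth {s} s∈ = proj₁ (reply 0) , proj₁ (proj₂ (reply 0)) ,
        ν-fromChain (λ _ → s) (proj₁ ∘ reply) (λ _ → refl)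
                    (λ n → proj₁ (agree n)) (proj₂ ∘ proj₂ ∘ reply) (proj₂ ∘ agree)
        where
        reply : ∀ n → ∃ λ t → t ∈ Opt q × Approx n s t
        reply n = proj₁ (proj₂ (a (suc n))) s∈

        agree : ∀ n → Σ (proj₁ (reply (suc n)) ≡ proj₁ (reply n)) λ e →
                Extends n refl e (proj₂ (proj₂ (reply (suc n)))) (proj₂ (proj₂ (reply n)))
        agree n = proj₁ (coherent (suc n)) s∈

      back : ∀ {t} → t ∈ Opt q → ∃ λ s → s ∈ Opt p × ν s t
      back {t} t∈ = proj₁ (reply 0) , proj₁ (proj₂ (reply 0)) ,
        ν-fromChain (proj₁ ∘ reply) (λ _ → t) (λ n → proj₁ (agree n))
                    (λ _ → refl) (proj₂ ∘ proj₂ ∘ reply) (proj₂ ∘ agree)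
        where
        reply : ∀ n → ∃ λ s → s ∈ Opt p × Approx n s t
        reply n = proj₂ (proj₂ (a (suc n))) t∈

        agree : ∀ n → Σ (proj₁ (reply (suc n)) ≡ proj₁ (reply n)) λ e →
                Extends n e refl (proj₂ (proj₂ (reply (suc n)))) (proj₂ (proj₂ (reply n)))
        agree n = proj₂ (coherent (suc n)) t∈

    module _ (X : Rel Pos ℓ) (X⇒E : X ⇒ E)
             (X-compatible : X ⇒ SameClasses G X) where

      approx : ∀ n → X ⇒ Approx n
      approx zero    _ = tt
      approx (suc n) x = X⇒E x , SameClasses-map (approx n) (X-compatible x)

      approx-coherent : ∀ n {p q} (x : X p q) →
                        Extends n refl refl (approx (suc n) x) (approx n x)
      approx-coherent zero    _ = tt
      approx-coherent (suc n) _ =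
        (λ _ → refl , approx-coherent n _) , (λ _ → refl , approx-coherent n _)

      ν-greatest : X ⇒ ν
      ν-greatest x = (λ n → approx n x) , (λ n → approx-coherent n x)

    ν-isEquivalence : IsEquivalence E → IsEquivalence ν
    ν-isEquivalence E-isEquivalence = record
      { refl  = ν-greatest _≡_ E.reflexive
                  (λ { refl → SameClasses-refl refl }) refl
      ; sym   = ν-greatest (flip ν) (E.sym ∘ ν⇒E)
                  (SameClasses-flip ∘ ν-compatible)
      ; trans = λ x y → ν-greatest (ν ; ν)
                  (λ (_ , x , y) → E.trans (ν⇒E x) (ν⇒E y))
                  (λ (_ , x , y) → SameClasses-compose (ν-compatible x) (ν-compatible y))
                  (_ , x , y)
      }
      where module E = IsEquivalence E-isEquivalence

  module _ {I : Set ℓ} (θs : I → Congruence G) where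

    ⋃ : Rel Pos ℓ
    ⋃ p q = ∃ λ i → rel (θs i) p q

    ⋂ : Rel Pos ℓ
    ⋂ p q = ∀ i → rel (θs i) p q

    ⨆ : Congruence G
    ⨆ = record
      { rel          = Star ⋃
      ; isCongruence = record
        { isEquivalence = record
          { refl  = ε
          ; sym   = reverse (λ (i , x) → i , Con.sym (θs i) x)
          ; trans = _◅◅_
          }
        ; compatible    = Star-compatible λ (i , x) →
            SameClasses-map (return ∘ (i ,_)) (Con.compatible (θs i) x)
        }
      }

    ⨆-isSupremum : IsSupremum G θs ⨆
    ⨆-isSupremum =
      (λ i → return ∘ (i ,_)) ,
      (λ τ θs⊑τ → fold (rel τ) (λ (i , x) → Con.trans τ (θs⊑τ i x)) (Con.refl τ))

    open GreatestCompatible ⋂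

    ⨅ : Congruence G
    ⨅ = record
      { rel          = ν
      ; isCongruence = record
        { isEquivalence = ν-isEquivalence record
          { refl  = λ i → Con.refl (θs i)
          ; sym   = λ x i → Con.sym (θs i) (x i)
          ; trans = λ x y i → Con.trans (θs i) (x i) (y i)
          }
        ; compatible    = ν-compatible
        }
      }

    ⨅-isInfimum : IsInfimum G θs ⨅
    ⨅-isInfimum =
      (λ i x → ν⇒E x i) ,
      (λ τ τ⊑θs → ν-greatest (rel τ) (λ x i → τ⊑θs i x) (Con.compatible τ))

mainTheorem7 : ∀ {ℓ : Level} (G : Optiongraph ℓ) → ConIsCompleteLattice G
mainTheorem7 G I θs = (⨆ G θs , ⨆-isSupremum G θs) , (⨅ G θs , ⨅-isInfimum G θs)
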